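{- Let $E$ be a set of designs based on $\beta$, and let $p$ and $q$ be two distinct paths of $V_E$. (i) If $p$ and $q$ are coherent, then $\widetilde p$ and $\widetilde q$ are not coherent. (ii) If $C$ is a clique of paths based on $\beta$ visitable in $E$, then $\widetilde C=\{\widetilde p:p\in C\}$ is an anticlique of paths based on $\beta^\perp$.
   Context: Ludics (Girard). Actions: proper $(\epsilon,\xi,I)$ with polarity $\epsilon\in\{+,-\}$, focus $\xi$ (a locus, i.e. finite sequence of naturals) and finite ramification $I$, or the positive daimon $\maltese$; $(\epsilon,\xi.i,J)$ is justified by $(\bar\epsilon,\xi,I)$ if $i\in I$; $\overline{(\pm,\xi,I)}=(\mp,\xi,I)$ letterwise on sequences. Views: $\ulcorner\epsilon\urcorner=\epsilon$, $\ulcorner w\kappa^+\urcorner=\ulcorner w\urcorner\kappa^+$, $\ulcorner w\kappa^-\urcorner=\ulcorner w_0\urcorner\kappa^-$, $w_0$ empty if $\kappa^-$ is initial (focus in the base), else the prefix of $w$ ending with the justifier of $\kappa^-$. Paths on a base of net (finite set of sequents $\Gamma_i\vdash\Delta_i$ of disjoint loci, each $\Gamma_i$ a singleton except at most one empty) are finite alternating sequences of actions hereditarily justified from the base, proper actions being justified by earlier ones or initial, with distinct focuses, daimon only last, every positive proper action justified by a negative action $\kappa'$ having $\kappa'$ in the view of the preceding prefix, initial positive actions on $\Delta_i$ being first (with $\Gamma_i=\emptyset$) or immediately preceded by a negative action hereditarily justified from $\Gamma_i\cup\Delta_i$, and non-empty starting with $\maltese$ or a positive action on $\Delta_i$ when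 some $\Gamma_i=\emptyset$. Two paths $p_1,p_2$ on the same base are coherent when: their first actions have the same polarity and are equal if positive; for prefixes $w_1\kappa_1^+,w_2\kappa_2^+$ with $\ulcorner w_1\urcorner=\ulcorner w_2\urcorner$, $\kappa_1^+=\kappa_2^+$; and for prefixes $w_1\kappa_1^-,w_2\kappa_2^-$, with $w_j^0$ empty if $\kappa_j^-$ is initial and otherwise the prefix of $p_j$ ending with the justifier of $\kappa_j^-$, if $\ulcorner w_1^0\urcorner=\ulcorner w_2^0\urcorner$ and $\kappa_1^-,\kappa_2^-$ have distinct focuses then all actions $\sigma_1,\sigma_2$ with $w_j\kappa_j^-w_j'\sigma_j$ a prefix of $p_j$ and $\kappa_j^-$ in $\ulcorner w_j\kappa_j^-w_j'\sigma_j\urcorner$ have distinct focuses. A clique is a set of pairwise coherent paths; an anticlique is a set of pairwise non-coherent paths. Designs are sets of chronicles as in Ludics; for a design on $\beta=\xi\vdash\sigma_1,\dots,\sigma_n$ (resp. $\vdash\sigma_1,\dots,\sigma_n$), $\beta^\perp$ is $\vdash\xi,\sigma_1\vdash,\dots,\sigma_n\vdash$ (resp. $\sigma_1\vdash,\dots,\sigma_n\vdash$); a net $\mathfrak R$ on $\beta^\perp$ is orthogonal to $\mathfrak D$ if normalization (cut-elimination) of $(\mathfrak D,\mathfrak R)$ converges; $E^\perp$ is the set of nets orthogonal to every design of $E$. $\langle\mathfrak D\leftarrow\mathfrak R\rangle$ is the sequence of actions of $\mathfrak D$ visited during normalization. $V_E$ is the set of paths visitable in $E$, i.e. of the form $\langle\mathfrak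 D\leftarrow\mathfrak R\rangle$ with $\mathfrak D\in E$, $\mathfrak R\in E^\perp$. Dual of a sequence: $\widetilde p=\overline w$ if $p=w\maltese$, else $\widetilde p=\overline p\maltese$. -}

module Defs where

open import Level using (Level)
open import Data.Bool using (Bool; true; false; _∧_; if_then_else_)
open import Data.Nat using (ℕ; zero; suc; _≡ᵇ_; _/_; _%_)
open import Data.Fin using (Fin)
open import Data.List using (List; []; _∷_; _++_; [_]; map; reverse; length; lookup)
open import Data.List.Membership.Propositional using (_∈_)
open import Data.List.Relation.Unary.AllPairs using (AllPairs)
open import Data.Maybe using (Maybe; just; nothing)
open import Data.Product using (Σ; _×_; _,_; ∃)
open import Data.Sum using (_⊎_)
open import Data.Empty using (⊥)
open import Relation.Nullary using (¬_)
open import Relation.Binary.PropositionalEquality using (_≡_; _≢_)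

Locus : Set
Locus = List ℕ

-- A finite ramification I ⊆ ℕ is encoded canonically by its bitmask:
-- i ∈ I  iff  bit i of the natural number I is 1.
Ram : Set
Ram = ℕ

testBit : Ram → ℕ → Bool
testBit n zero    = (n % 2) ≡ᵇ 1
testBit n (suc i) = testBit (n / 2) i

_∈R_ : ℕ → Ram → Set
i ∈R I = testBit I i ≡ true

data Pol : Set where
  plus minus : Pol

flipPol : Pol → Pol
flipPol plus  = minus
flipPol minus = plus

polEqᵇ : Pol → Pol → Bool
polEqᵇ plus  plus  = true
polEqᵇ minus minus = true
polEqᵇ _     _     = false

data Action : Set where
  daimon : Action
  act    : Pol → Locus → Ram → Action

pol : Action → Pol
pol daimon      = plus
pol (act e _ _) = e

focus : Action → Maybe Locus
focus daimon      = nothing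
focus (act _ ξ _) = just ξ

Proper : Action → Set
Proper κ = Σ Locus λ ξ → focus κ ≡ just ξ

DistinctFoci : Action → Action → Set
DistinctFoci a b = ∀ ξ → focus a ≡ just ξ → focus b ≡ just ξ → ⊥

-- childIndex ξ ζ = just i  iff  ζ = ξ.i
childIndex : Locus → Locus → Maybe ℕ
childIndex []      (i ∷ []) = just i
childIndex []      _        = nothing
childIndex (a ∷ ξ) []       = nothing
childIndex (a ∷ ξ) (b ∷ ζ)  = if a ≡ᵇ b then childIndex ξ ζ else nothing

-- (ε, ξ.i, J) is justified by (ε̄, ξ, I) when i ∈ I
justifiesᵇ : Action → Action → Bool
justifiesᵇ daimon        _              = false
justifiesᵇ (act _ _ _)   daimon         = false
justifiesᵇ (act e ξ I)   (act e' ζ J) with childIndex ξ ζ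
... | just i  = polEqᵇ e' (flipPol e) ∧ testBit I i
... | nothing = false

Justifies : Action → Action → Set
Justifies a b = justifiesᵇ a b ≡ true

dualAct : Action → Action
dualAct daimon      = daimon
dualAct (act e ξ I) = act (flipPol e) ξ I

dualSeq : List Action → List Action
dualSeq = map dualAct

-- p~ = w̄ if p = w ✠, and p̄ ✠ otherwise (computed on the reversed sequence)
tildeR : List Action → List Action
tildeR []               = daimon ∷ []
tildeR (daimon ∷ w)     = map dualAct w
tildeR (act e ξ I ∷ w)  = daimon ∷ act (flipPol e) ξ I ∷ map dualAct w

tilde : List Action → List Action
tilde p = reverse (tildeR (reverse p))

isPos : Action → Bool
isPos κ = polEqᵇ (pol κ) plus

-- on reversed sequences: drop until the (last) justifier of κ, kept; [] if none
dropTo : Action → List Action → List Action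
dropTo κ []      = []
dropTo κ (a ∷ w) = if justifiesᵇ a κ then a ∷ w else dropTo κ w

mutual
  -- view of a reversed sequence, result reversed
  rview : List Action → List Action
  rview []      = []
  rview (κ ∷ w) = if isPos κ then κ ∷ rview w else κ ∷ rviewFrom κ w

  rviewFrom : Action → List Action → List Action
  rviewFrom κ []            = []
  rviewFrom κ w@(a ∷ w')    = if justifiesᵇ a κ then rview w else rviewFrom κ w'

-- ⌜w⌝ ; for a negative action with no justifier in w (initial) the view restarts
view : List Action → List Action
view w = reverse (rview (reverse w))

-- w⁰ : prefix of w ending with the justifier of κ, empty if there is none
jprefix : Action → List Action → List Action
jprefix κ w = reverse (dropTo κ (reverse w))

record Sequent : Set where
  constructor _⊢_
  field
    sneg : Maybe Locus
    spos : List Locus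
open Sequent public

gam : Sequent → List Locus
gam s with sneg s
... | just ξ  = ξ ∷ []
... | nothing = []

loci : Sequent → List Locus
loci s = gam s ++ spos s

LPrefix : Locus → Locus → Set
LPrefix a b = Σ Locus λ r → a ++ r ≡ b

WFBase : Sequent → Set
WFBase s = AllPairs (λ a b → ¬ LPrefix a b × ¬ LPrefix b a) (loci s)

NetBase : Set
NetBase = List Sequent

perpHead : Maybe Locus → NetBase
perpHead (just ξ) = (nothing ⊢ (ξ ∷ [])) ∷ []
perpHead nothing  = []

perp : Sequent → NetBase
perp β = perpHead (sneg β) ++ map (λ σ → just σ ⊢ []) (spos β)

FocusIn : Action → List Locus → Set
FocusIn κ L = Σ Locus λ ξ → focus κ ≡ just ξ × ξ ∈ L

InitialIn : NetBase → Action → Set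
InitialIn B κ = Σ Sequent λ s → s ∈ B ×
  ((pol κ ≡ minus × FocusIn κ (gam s)) ⊎ (pol κ ≡ plus × FocusIn κ (spos s)))

-- hereditarily justified from Γᵢ ∪ Δᵢ : focus extends a locus of the sequent
HJFrom : Sequent → Action → Set
HJFrom s κ = Σ Locus λ ξ → Σ Locus λ ζ → focus κ ≡ just ζ × ξ ∈ loci s × LPrefix ξ ζ

record IsPath (B : NetBase) (p : List Action) : Set where
  field
    alternating : ∀ u a b r → p ≡ u ++ a ∷ b ∷ r → pol a ≢ pol b
    daimonLast  : ∀ u r → p ≡ u ++ daimon ∷ r → r ≡ []
    distinct    : ∀ u a v b r → p ≡ u ++ a ∷ v ++ b ∷ r → DistinctFoci a b
    justified   : ∀ u κ r → p ≡ u ++ κ ∷ r → Proper κ →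
                  InitialIn B κ ⊎ (Σ Action λ κ' → κ' ∈ u × Justifies κ' κ)
    visibility  : ∀ u κ r κ' → p ≡ u ++ κ ∷ r → pol κ ≡ plus →
                  κ' ∈ u → Justifies κ' κ → κ' ∈ view u
    initPos     : ∀ u κ r s → p ≡ u ++ κ ∷ r → pol κ ≡ plus → s ∈ B → FocusIn κ (spos s) →
                  (u ≡ [] × sneg s ≡ nothing) ⊎
                  (Σ (List Action) λ u' → Σ Action λ κ'' →
                     u ≡ u' ++ κ'' ∷ [] × pol κ'' ≡ minus × HJFrom s κ'')
    start       : ∀ s → s ∈ B → sneg s ≡ nothing →
                  Σ Action λ κ → Σ (List Action) λ r → p ≡ κ ∷ r ×
                    (κ ≡ daimon ⊎ (pol κ ≡ plus × FocusIn κ (spos s)))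

Coherent : List Action → List Action → Set
Coherent p₁ p₂ =
  (∀ κ₁ r₁ κ₂ r₂ → p₁ ≡ κ₁ ∷ r₁ → p₂ ≡ κ₂ ∷ r₂ →
     pol κ₁ ≡ pol κ₂ × (pol κ₁ ≡ plus → κ₁ ≡ κ₂))
  ×
  (∀ w₁ κ₁ r₁ w₂ κ₂ r₂ → p₁ ≡ w₁ ++ κ₁ ∷ r₁ → p₂ ≡ w₂ ++ κ₂ ∷ r₂ →
     pol κ₁ ≡ plus → pol κ₂ ≡ plus → view w₁ ≡ view w₂ → κ₁ ≡ κ₂)
  ×
  (∀ w₁ κ₁ r₁ w₂ κ₂ r₂ → p₁ ≡ w₁ ++ κ₁ ∷ r₁ → p₂ ≡ w₂ ++ κ₂ ∷ r₂ →
     pol κ₁ ≡ minus → pol κ₂ ≡ minus →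
     view (jprefix κ₁ w₁) ≡ view (jprefix κ₂ w₂) → DistinctFoci κ₁ κ₂ →
     ∀ v₁ σ₁ s₁ v₂ σ₂ s₂ → r₁ ≡ v₁ ++ σ₁ ∷ s₁ → r₂ ≡ v₂ ++ σ₂ ∷ s₂ →
     κ₁ ∈ view (w₁ ++ κ₁ ∷ v₁ ++ σ₁ ∷ []) →
     κ₂ ∈ view (w₂ ++ κ₂ ∷ v₂ ++ σ₂ ∷ []) →
     DistinctFoci σ₁ σ₂)

Clique : {ℓ : Level} → (List Action → Set ℓ) → Set ℓ
Clique C = ∀ p q → C p → C q → p ≢ q → Coherent p q

AntiClique : {ℓ : Level} → (List Action → Set ℓ) → Set ℓ
AntiClique C = ∀ p q → C p → C q → p ≢ q → ¬ Coherent p q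

TildeSet : {ℓ : Level} → (List Action → Set ℓ) → List Action → Set ℓ
TildeSet C x = Σ (List Action) λ p → C p × x ≡ tilde p

firstPol : Sequent → Pol
firstPol s with sneg s
... | just _  = minus
... | nothing = plus

record IsChronicle (s : Sequent) (c : List Action) : Set where
  field
    first       : Σ Action λ κ → Σ (List Action) λ r → c ≡ κ ∷ r × pol κ ≡ firstPol s
    alternating : ∀ u a b r → c ≡ u ++ a ∷ b ∷ r → pol a ≢ pol b
    daimonLast  : ∀ u r → c ≡ u ++ daimon ∷ r → r ≡ []
    distinct    : ∀ u a v b r → c ≡ u ++ a ∷ v ++ b ∷ r → DistinctFoci a b
    negJust     : ∀ u κ r → c ≡ u ++ κ ∷ r → pol κ ≡ minus →
                  (u ≡ [] × FocusIn κ (gam s)) ⊎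
                  (Σ (List Action) λ u' → Σ Action λ κ' → u ≡ u' ++ κ' ∷ [] × Justifies κ' κ)
    posJust     : ∀ u κ r → c ≡ u ++ κ ∷ r → pol κ ≡ plus → Proper κ →
                  FocusIn κ (spos s) ⊎ (Σ Action λ κ' → κ' ∈ u × Justifies κ' κ)

CohChron : List Action → List Action → Set
CohChron c₁ c₂ =
  (Σ (List Action) (λ r → c₁ ++ r ≡ c₂) ⊎ Σ (List Action) (λ r → c₂ ++ r ≡ c₁)) ⊎
  (Σ (List Action) λ w → Σ Action λ κ₁ → Σ Action λ κ₂ →
   Σ (List Action) λ r₁ → Σ (List Action) λ r₂ →
     c₁ ≡ w ++ κ₁ ∷ r₁ × c₂ ≡ w ++ κ₂ ∷ r₂ × κ₁ ≢ κ₂ ×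
     pol κ₁ ≡ minus × pol κ₂ ≡ minus ×
     (DistinctFoci κ₁ κ₂ → ∀ σ₁ σ₂ → σ₁ ∈ r₁ → σ₂ ∈ r₂ → DistinctFoci σ₁ σ₂))

LastPositive : List Action → Set
LastPositive c = Σ (List Action) λ u → Σ Action λ κ → c ≡ u ++ κ ∷ [] × pol κ ≡ plus

record Design (s : Sequent) : Set₁ where
  field
    chr         : List Action → Set
    chronicles  : ∀ c → chr c → IsChronicle s c
    arborescence : ∀ u r → u ≢ [] → chr (u ++ r) → chr u
    coherence   : ∀ c d → chr c → chr d → CohChron c d
    positivity  : ∀ c → chr c → (∀ r → r ≢ [] → ¬ chr (c ++ r)) → LastPositive c
    totality    : sneg s ≡ nothing → Σ (List Action) chr
open Design public

Net : NetBase → Set₁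
Net B = (i : Fin (length B)) → Design (lookup B i)

-- The interaction is the sequence of actions, written with D's polarities;
-- each positive (for D) action must extend a chronicle of D (the view of the
-- current prefix), each negative (for D) action is played by the net R:
-- the view of the dual prefix is a chronicle of some design of R.

StepOK : {β : Sequent} → Design β → Net (perp β) → List Action → Action → Set
StepOK D R u κ =
  (pol κ ≡ plus × chr D (view (u ++ κ ∷ [])))
  ⊎ (pol κ ≡ minus × Σ (Fin _) λ i → chr (R i) (view (dualSeq (u ++ κ ∷ []))))

Steps : {β : Sequent} → Design β → Net (perp β) → List Action → Set
Steps D R p = ∀ u κ r → p ≡ u ++ κ ∷ r → StepOK D R u κ

-- Visit D R p : normalization of (D,R) converges and p = ⟨D ← R⟩
-- (either D plays the final daimon, included in p, or R does, and then
--  no action of D is added)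
Visit : {β : Sequent} → Design β → Net (perp β) → List Action → Set
Visit D R p = Steps D R p ×
  ((Σ (List Action) λ w → p ≡ w ++ daimon ∷ [])
   ⊎ (¬ (daimon ∈ p) × Σ (Fin _) λ i → chr (R i) (view (dualSeq p ++ daimon ∷ []))))

Converges : {β : Sequent} → Design β → Net (perp β) → Set
Converges D R = Σ (List Action) (Visit D R)

Orth : {β : Sequent} → (Design β → Set) → Net (perp β) → Set₁
Orth {β} E R = ∀ (D : Design β) → E D → Converges D R

Visitable : {β : Sequent} → (Design β → Set) → List Action → Set₁
Visitable {β} E p = Σ (Design β) λ D → Σ (Net (perp β)) λ R → E D × Orth E R × Visit D R p

-- (i) Let p and q first differ after a common prefix w, with actions a ≠ b. If a and b are
-- positive, coherence of p and q forces a = b. If both are negative, their duals are positive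
-- actions of p̃ and q̃ after the common prefix w̄, and coherence of p̃ and q̃ forces them equal.
-- A fork between a positive and a negative action cannot occur in two visits: the action
-- before it, or at the very start the base β, fixes the polarity of the next one. If q
-- strictly extends p, the normalization of p was stopped by a ✠ of the net (a ✠ of the design
-- would also end q), so p̃ = p̄✠ while q̃ continues p̄ with the dual of the next action b of q:
-- two positive actions after the same view, unless b is positive, which alternation or the
-- base again excludes.
-- (ii) The anticlique is (i). Apart from a final ✠, every action of p̃ is the dual of an action
-- of p, so the conditions on paths transfer from p; the new positive actions, duals of the
-- negative actions of p, satisfy visibility because the net played them on its own views.

module Submission where

open import Defs
open import Data.List using (List; _∷_; [])
open import Data.Product using (_×_)
open import Relation.Nullary using (¬_)
open import Relation.Binary.PropositionalEquality using (_≢_)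

open import Function using (_∘_)
open import Data.Empty using (⊥; ⊥-elim)
open import Data.Bool using (true; false)
open import Data.Nat as ℕ using (_≡ᵇ_)
open import Data.Nat.Properties using (≡ᵇ⇒≡)
open import Data.List using (_++_; _∷ʳ_; [_]; map; reverse; lookup; initLast; _∷ʳ′_)
open import Data.List.Properties
  using (≡-dec; ∷-injective; ∷ʳ-injective; ∷ʳ-injectiveˡ; ∷ʳ-++; ++-assoc; ++-conicalʳ; map-++;
         unfold-reverse; reverse-++; reverse-injective)
open import Data.List.Membership.Propositional using (_∈_; _∉_)
open import Data.List.Membership.Propositional.Properties
  using (∈-map⁺; ∈-map⁻; ∈-++⁺ʳ; ∈-++⁻; ∈-∃++; ∈-lookup)
open import Data.List.Relation.Unary.Any using (here; there)
open import Data.List.Relation.Unary.Any.Properties using (reverse⁻)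
open import Data.Maybe using (just; nothing)
open import Data.Maybe.Properties using (just-injective)
open import Data.Product using (Σ; ∃; ∃₂; _,_; proj₁; proj₂)
open import Data.Sum using (_⊎_; inj₁; inj₂)
import Data.Sum as Sum
open import Relation.Nullary using (yes; no)
open import Relation.Binary.Definitions using (DecidableEquality)
open import Relation.Binary.PropositionalEquality
  using (_≡_; refl; sym; trans; cong; cong₂; subst; module ≡-Reasoning)
open ≡-Reasoning

private
  variable
    A : Set
    a b κ : Action
    r : List Action

++-∷≢[] : ∀ (u : List A) {x xs} → u ++ x ∷ xs ≢ []
++-∷≢[] u eq with ++-conicalʳ u _ eq
... | ()

∉-++-∷ : ∀ (u : List A) {x y ys} → x ∉ u ++ y ∷ ys → y ≢ x
∉-++-∷ u x∉ refl = x∉ (∈-++⁺ʳ u (here refl))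

map-split : ∀ {B : Set} (f : A → B) l u {y} r → map f l ≡ u ++ y ∷ r →
  ∃₂ λ u₀ x → ∃ λ r₀ → l ≡ u₀ ++ x ∷ r₀ × u ≡ map f u₀ × y ≡ f x × r ≡ map f r₀
map-split f (x ∷ l) [] r eq with refl , refl ← ∷-injective eq = [] , x , l , refl , refl , refl , refl
map-split f (x ∷ l) (_ ∷ u) r eq with refl , eq′ ← ∷-injective eq
                                 with u₀ , x₀ , r₀ , refl , refl , refl , refl ← map-split f l u r eq′
  = x ∷ u₀ , x₀ , r₀ , refl , refl , refl , refl

map-≡-∷ʳ : ∀ {B : Set} (f : A → B) l u {y} → map f l ≡ u ∷ʳ y →
  ∃₂ λ l₀ x → l ≡ l₀ ∷ʳ x × u ≡ map f l₀ × y ≡ f x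
map-≡-∷ʳ f l u eq with initLast l
... | []       = ⊥-elim (++-∷≢[] u (sym eq))
... | l₀ ∷ʳ′ x with refl , refl ← ∷ʳ-injective (map f l₀) u (trans (sym (map-++ f l₀ [ x ])) eq) =
  l₀ , x , refl , refl , refl

∷ʳ-split : ∀ (xs : List A) x u {y} r → xs ∷ʳ x ≡ u ++ y ∷ r →
  (∃ λ r₀ → xs ≡ u ++ y ∷ r₀) ⊎ (u ≡ xs × y ≡ x × r ≡ [])
∷ʳ-split xs x u r eq with initLast r
... | [] with refl , refl ← ∷ʳ-injective xs u eq = inj₂ (refl , refl , refl)
... | r₀ ∷ʳ′ z = inj₁ (r₀ , ∷ʳ-injectiveˡ xs (u ++ _ ∷ r₀) (trans eq (sym (++-assoc u (_ ∷ r₀) [ z ]))))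

data Comparison {A : Set} : List A → List A → Set where
  equal     : ∀ {p} → Comparison p p
  fork      : ∀ w {a b} r s → a ≢ b → Comparison (w ++ a ∷ r) (w ++ b ∷ s)
  prefix    : ∀ p b s → Comparison p (p ++ b ∷ s)
  extension : ∀ q a r → Comparison (q ++ a ∷ r) q

compare : DecidableEquality A → ∀ p q → Comparison p q
compare _≟_ []      []      = equal
compare _≟_ []      (b ∷ s) = prefix [] b s
compare _≟_ (a ∷ r) []      = extension [] a r
compare _≟_ (a ∷ r) (b ∷ s) with a ≟ b
... | no a≢b = fork [] r s a≢b
... | yes refl with compare _≟_ r s
...   | equal            = equal
...   | fork w r′ s′ ne  = fork (a ∷ w) r′ s′ ne
...   | prefix _ b′ s′   = prefix (a ∷ r) b′ s′
...   | extension _ a′ r′ = extension (a ∷ s) a′ r′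

plus≢minus : plus ≢ minus
plus≢minus ()

pol-plus⊎minus : ∀ a → pol a ≡ plus ⊎ pol a ≡ minus
pol-plus⊎minus daimon          = inj₁ refl
pol-plus⊎minus (act plus _ _)  = inj₁ refl
pol-plus⊎minus (act minus _ _) = inj₂ refl

Proper⇒≢daimon : Proper a → a ≢ daimon
Proper⇒≢daimon (_ , ()) refl

≢daimon⇒Proper : a ≢ daimon → Proper a
≢daimon⇒Proper {daimon}     a≢✠ = ⊥-elim (a≢✠ refl)
≢daimon⇒Proper {act _ ξ _} _   = ξ , refl

minus⇒≢daimon : pol a ≡ minus → a ≢ daimon
minus⇒≢daimon () refl

flipPol-involutive : ∀ e → flipPol (flipPol e) ≡ e
flipPol-involutive plus  = refl
flipPol-involutive minus = refl

dualAct-involutive : ∀ a → dualAct (dualAct a) ≡ a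
dualAct-involutive daimon      = refl
dualAct-involutive (act e ξ I) = cong (λ e′ → act e′ ξ I) (flipPol-involutive e)

dualAct-injective : ∀ {a b} → dualAct a ≡ dualAct b → a ≡ b
dualAct-injective {a} {b} eq = begin
  a                   ≡⟨ sym (dualAct-involutive a) ⟩
  dualAct (dualAct a) ≡⟨ cong dualAct eq ⟩
  dualAct (dualAct b) ≡⟨ dualAct-involutive b ⟩
  b                   ∎

focus-dualAct : ∀ a → focus (dualAct a) ≡ focus a
focus-dualAct daimon      = refl
focus-dualAct (act _ _ _) = refl

pol-dualAct-minus : ∀ a → pol a ≡ minus → pol (dualAct a) ≡ plus
pol-dualAct-minus (act minus _ _) refl = refl

pol-dualAct-plus : a ≢ daimon → pol a ≡ plus → pol (dualAct a) ≡ minus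
pol-dualAct-plus {daimon}        a≢✠ _ = ⊥-elim (a≢✠ refl)
pol-dualAct-plus {act plus _ _}  _   _ = refl

pol-dualAct≡plus⇒minus : a ≢ daimon → pol (dualAct a) ≡ plus → pol a ≡ minus
pol-dualAct≡plus⇒minus {daimon}         a≢✠ _ = ⊥-elim (a≢✠ refl)
pol-dualAct≡plus⇒minus {act minus _ _}  _   _ = refl

pol-dualAct-≢ : a ≢ daimon → b ≢ daimon → pol a ≢ pol b → pol (dualAct a) ≢ pol (dualAct b)
pol-dualAct-≢ {daimon}        a≢✠ _   _ = ⊥-elim (a≢✠ refl)
pol-dualAct-≢ {act _ _ _} {daimon} _ b≢✠ _ = ⊥-elim (b≢✠ refl)
pol-dualAct-≢ {act plus _ _}  {act plus _ _}  _ _ ne _ = ne refl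
pol-dualAct-≢ {act minus _ _} {act minus _ _} _ _ ne _ = ne refl
pol-dualAct-≢ {act plus _ _}  {act minus _ _} _ _ _ ()
pol-dualAct-≢ {act minus _ _} {act plus _ _}  _ _ _ ()

_≟ₚ_ : DecidableEquality Pol
plus  ≟ₚ plus  = yes refl
minus ≟ₚ minus = yes refl
plus  ≟ₚ minus = no λ ()
minus ≟ₚ plus  = no λ ()

_≟ₐ_ : DecidableEquality Action
daimon      ≟ₐ daimon      = yes refl
daimon      ≟ₐ act _ _ _   = no λ ()
act _ _ _   ≟ₐ daimon      = no λ ()
act e ξ I ≟ₐ act e′ ξ′ I′ with e ≟ₚ e′ | ≡-dec ℕ._≟_ ξ ξ′ | I ℕ.≟ I′
... | yes refl | yes refl | yes refl = yes refl
... | no e≢e′  | _        | _        = no λ { refl → e≢e′ refl }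
... | yes _    | no ξ≢ξ′  | _        = no λ { refl → ξ≢ξ′ refl }
... | yes _    | yes _    | no I≢I′  = no λ { refl → I≢I′ refl }

childIndex-sound : ∀ ξ ζ {i} → childIndex ξ ζ ≡ just i → ζ ≡ ξ ∷ʳ i
childIndex-sound []      (_ ∷ [])    refl = refl
childIndex-sound []      []          ()
childIndex-sound []      (_ ∷ _ ∷ _) ()
childIndex-sound (_ ∷ _) []          ()
childIndex-sound (x ∷ ξ) (y ∷ ζ) eq with x ≡ᵇ y | ≡ᵇ⇒≡ x y
... | true  | x≡y = cong₂ _∷_ (sym (x≡y _)) (childIndex-sound ξ ζ eq)
... | false | _   with () ← eq

justifier-focus : ∀ a κ → Justifies a κ → ∃₂ λ ξ i → focus a ≡ just ξ × focus κ ≡ just (ξ ∷ʳ i)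
justifier-focus (act _ ξ _) (act _ ζ _) J with childIndex ξ ζ in eq
... | just i = ξ , i , refl , cong just (childIndex-sound ξ ζ eq)

justifier-focus-unique : ∀ a b κ → Justifies a κ → Justifies b κ → focus a ≡ focus b
justifier-focus-unique a b κ Ja Jb with justifier-focus a κ Ja | justifier-focus b κ Jb
... | ξ , _ , fa , fκ | ξ′ , _ , fb , fκ′
  with refl ← ∷ʳ-injectiveˡ ξ ξ′ (just-injective (trans (sym fκ) fκ′)) = trans fa (sym fb)

polEqᵇ-flipPol : ∀ e e′ → polEqᵇ (flipPol e′) (flipPol (flipPol e)) ≡ polEqᵇ e′ (flipPol e)
polEqᵇ-flipPol plus  plus  = refl
polEqᵇ-flipPol plus  minus = refl
polEqᵇ-flipPol minus plus  = refl
polEqᵇ-flipPol minus minus = refl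

justifies-dualAct : ∀ a κ → Justifies a κ → Justifies (dualAct a) (dualAct κ)
justifies-dualAct (act e ξ _) (act e′ ζ _) J with childIndex ξ ζ
... | just i rewrite polEqᵇ-flipPol e e′ = J

AllDistinctFoci : List Action → Set
AllDistinctFoci l = ∀ u a v b r → l ≡ u ++ a ∷ v ++ b ∷ r → DistinctFoci a b

AllDistinctFoci-++⁻ˡ : ∀ l t → AllDistinctFoci (l ++ t) → AllDistinctFoci l
AllDistinctFoci-++⁻ˡ l t distinct u a v b r refl = distinct u a v b (r ++ t) (begin
  (u ++ a ∷ v ++ b ∷ r) ++ t ≡⟨ ++-assoc u (a ∷ v ++ b ∷ r) t ⟩
  u ++ a ∷ (v ++ b ∷ r) ++ t ≡⟨ cong (λ x → u ++ a ∷ x) (++-assoc v (b ∷ r) t) ⟩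
  u ++ a ∷ v ++ b ∷ r ++ t   ∎)

AllDistinctFoci⇒focus-injective : ∀ {l ζ} → AllDistinctFoci l → a ∈ l → b ∈ l →
  focus a ≡ just ζ → focus b ≡ just ζ → a ≡ b
AllDistinctFoci⇒focus-injective {a} {b} {l} {ζ} distinct a∈ b∈ fa fb with ∈-∃++ a∈
... | u , r , refl with ∈-++⁻ u b∈
...   | inj₂ (here b≡a) = sym b≡a
...   | inj₁ b∈u with u₁ , u₂ , refl ← ∈-∃++ b∈u =
  ⊥-elim (distinct u₁ b u₂ a r (++-assoc u₁ (b ∷ u₂) (a ∷ r)) ζ fb fa)
...   | inj₂ (there b∈r) with r₁ , r₂ , refl ← ∈-∃++ b∈r = ⊥-elim (distinct u a r₁ b r₂ refl ζ fa fb)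

-- Views and chronicles

rview-∷-plus : ∀ κ w → pol κ ≡ plus → rview (κ ∷ w) ≡ κ ∷ rview w
rview-∷-plus κ w pκ rewrite pκ = refl

view-∷ʳ-plus : ∀ w κ → pol κ ≡ plus → view (w ∷ʳ κ) ≡ view w ∷ʳ κ
view-∷ʳ-plus w κ pκ = begin
  reverse (rview (reverse (w ∷ʳ κ))) ≡⟨ cong (reverse ∘ rview) (reverse-++ w [ κ ]) ⟩
  reverse (rview (κ ∷ reverse w))    ≡⟨ cong reverse (rview-∷-plus κ (reverse w) pκ) ⟩
  reverse (κ ∷ rview (reverse w))    ≡⟨ unfold-reverse κ (rview (reverse w)) ⟩
  view w ∷ʳ κ                        ∎

mutual
  rview-⊆ : ∀ w → a ∈ rview w → a ∈ w
  rview-⊆ (κ ∷ w) a∈ with isPos κ | a∈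
  ... | true  | here a≡κ = here a≡κ
  ... | true  | there a∈′ = there (rview-⊆ w a∈′)
  ... | false | here a≡κ = here a≡κ
  ... | false | there a∈′ = there (rviewFrom-⊆ κ w a∈′)

  rviewFrom-⊆ : ∀ κ w → a ∈ rviewFrom κ w → a ∈ w
  rviewFrom-⊆ κ (b ∷ w) a∈ with justifiesᵇ b κ | a∈
  ... | true  | a∈′ = rview-⊆ (b ∷ w) a∈′
  ... | false | a∈′ = there (rviewFrom-⊆ κ w a∈′)

view-⊆ : ∀ w → a ∈ view w → a ∈ w
view-⊆ w = reverse⁻ ∘ rview-⊆ (reverse w) ∘ reverse⁻

chronicle-head-pol : ∀ {s} → IsChronicle s (κ ∷ r) → pol κ ≡ firstPol s
chronicle-head-pol ch with IsChronicle.first ch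
... | _ , _ , refl , pκ = pκ

chronicle-¬plus-plus : ∀ {s} w a b → IsChronicle s (view (w ∷ʳ a) ∷ʳ b) →
  pol a ≡ plus → pol b ≡ plus → ⊥
chronicle-¬plus-plus w a b ch pa pb =
  IsChronicle.alternating ch (view w) a b [] chronicle≡ (trans pa (sym pb))
  where
  chronicle≡ : view (w ∷ʳ a) ∷ʳ b ≡ view w ++ a ∷ b ∷ []
  chronicle≡ = begin
    view (w ∷ʳ a) ∷ʳ b   ≡⟨ cong (_∷ʳ b) (view-∷ʳ-plus w a pa) ⟩
    (view w ∷ʳ a) ∷ʳ b   ≡⟨ ++-assoc (view w) [ a ] [ b ] ⟩
    view w ++ a ∷ b ∷ [] ∎

LastNotNegative : List Action → Set
LastNotNegative p = ∀ w c → p ≡ w ∷ʳ c → pol c ≢ minus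

-- Bases and their duals

firstPol-perp : ∀ β → firstPol β ≡ plus → ∀ i → firstPol (lookup (perp β) i) ≡ minus
firstPol-perp (nothing ⊢ Δ) _ i with ∈-map⁻ (λ σ → just σ ⊢ []) (∈-lookup {xs = perp (nothing ⊢ Δ)} i)
... | _ , _ , s≡ = cong firstPol s≡

perp-spos : ∀ β {s ζ} → s ∈ perp β → ζ ∈ spos s → sneg β ≡ just ζ × sneg s ≡ nothing
perp-spos (just ξ ⊢ Δ) (here refl) (here refl) = refl , refl
perp-spos (just ξ ⊢ Δ) (there s∈) ζ∈ with _ , _ , refl ← ∈-map⁻ (λ σ → just σ ⊢ []) s∈ with () ← ζ∈
perp-spos (nothing ⊢ Δ) s∈ ζ∈ with _ , _ , refl ← ∈-map⁻ (λ σ → just σ ⊢ []) s∈ with () ← ζ∈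

initialIn-perp : ∀ β κ → InitialIn (β ∷ []) κ → InitialIn (perp β) (dualAct κ)
initialIn-perp (just ξ ⊢ Δ) κ (_ , here refl , inj₁ (pκ , ζ , fκ , ζ∈)) =
  nothing ⊢ (ξ ∷ []) , here refl , inj₂ (pol-dualAct-minus κ pκ , ζ , trans (focus-dualAct κ) fκ , ζ∈)
initialIn-perp (just ξ ⊢ Δ) κ (_ , here refl , inj₂ (pκ , ζ , fκ , ζ∈)) =
  just ζ ⊢ [] , there (∈-map⁺ (λ σ → just σ ⊢ []) ζ∈) ,
  inj₁ (pol-dualAct-plus (Proper⇒≢daimon (ζ , fκ)) pκ , ζ , trans (focus-dualAct κ) fκ , here refl)
initialIn-perp (nothing ⊢ Δ) κ (_ , here refl , inj₂ (pκ , ζ , fκ , ζ∈)) =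
  just ζ ⊢ [] , ∈-map⁺ (λ σ → just σ ⊢ []) ζ∈ ,
  inj₁ (pol-dualAct-plus (Proper⇒≢daimon (ζ , fκ)) pκ , ζ , trans (focus-dualAct κ) fκ , here refl)

negBase-path-head : ∀ {ξ Δ a r} → IsPath ((just ξ ⊢ Δ) ∷ []) (a ∷ r) → a ≢ daimon →
  pol a ≡ minus × focus a ≡ just ξ
negBase-path-head {a = a} {r} path a≢✠ with IsPath.justified path [] a r refl (≢daimon⇒Proper a≢✠)
... | inj₂ (_ , () , _)
... | inj₁ (_ , there () , _)
... | inj₁ (_ , here refl , inj₁ (pa , _ , fa , here refl)) = pa , fa
... | inj₁ (_ , here refl , inj₁ (_ , _ , _ , there ()))
... | inj₁ (s , here refl , inj₂ (pa , fin)) with IsPath.initPos path [] a r s refl pa (here refl) fin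
...   | inj₁ (_ , ())
...   | inj₂ (u , _ , eq , _) = ⊥-elim (++-∷≢[] u (sym eq))

negBase-path-focus : ∀ {β ξ p} → IsPath (β ∷ []) p → sneg β ≡ just ξ →
  ∀ u κ r → p ≡ u ++ κ ∷ r → focus κ ≡ just ξ → u ≡ []
negBase-path-focus _ _ [] _ _ _ _ = refl
negBase-path-focus path _ (daimon ∷ u) κ r refl _ =
  ⊥-elim (++-∷≢[] u (IsPath.daimonLast path [] (u ++ κ ∷ r) refl))
negBase-path-focus {just ξ ⊢ _} path refl (act e ζ I ∷ u) κ r refl fκ
  with _ , fa ← negBase-path-head path (λ ()) =
  ⊥-elim (IsPath.distinct path [] (act e ζ I) u κ r refl ξ fa fκ)

-- Normalization

opening-clash : ∀ {β} (D : Design β) (R : Net (perp β)) i {κ r κ′ r′} →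
  chr D (κ ∷ r) → chr (R i) (κ′ ∷ r′) → pol κ ≡ plus → pol κ′ ≡ plus → ⊥
opening-clash {β} D R i {κ} {κ′ = κ′} cD cR pκ pκ′ = plus≢minus (begin
  plus                         ≡⟨ sym pκ′ ⟩
  pol κ′                       ≡⟨ chronicle-head-pol (chronicles (R i) _ cR) ⟩
  firstPol (lookup (perp β) i) ≡⟨ firstPol-perp β β-positive i ⟩
  minus                        ∎)
  where
  β-positive : firstPol β ≡ plus
  β-positive = trans (sym (chronicle-head-pol (chronicles D _ cD))) pκ

module _ {β : Sequent} (D : Design β) (R : Net (perp β)) {p : List Action} (steps : Steps D R p) where

  steps-design : ∀ u κ r → p ≡ u ++ κ ∷ r → pol κ ≡ plus → chr D (view u ∷ʳ κ)
  steps-design u κ r eq pκ with steps u κ r eq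
  ... | inj₁ (_ , ch)  = subst (chr D) (view-∷ʳ-plus u κ pκ) ch
  ... | inj₂ (pκ′ , _) = ⊥-elim (plus≢minus (trans (sym pκ) pκ′))

  steps-net : ∀ u κ r → p ≡ u ++ κ ∷ r → pol κ ≡ minus →
    ∃ λ i → chr (R i) (view (dualSeq u) ∷ʳ dualAct κ)
  steps-net u κ r eq pκ with steps u κ r eq
  ... | inj₁ (pκ′ , _)   = ⊥-elim (plus≢minus (trans (sym pκ′) pκ))
  ... | inj₂ (_ , i , ch) = i , subst (chr (R i)) dual-view≡ ch
    where
    dual-view≡ : view (dualSeq (u ∷ʳ κ)) ≡ view (dualSeq u) ∷ʳ dualAct κ
    dual-view≡ = begin
      view (dualSeq (u ∷ʳ κ))        ≡⟨ cong view (map-++ dualAct u [ κ ]) ⟩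
      view (dualSeq u ∷ʳ dualAct κ)  ≡⟨ view-∷ʳ-plus (dualSeq u) (dualAct κ) (pol-dualAct-minus κ pκ) ⟩
      view (dualSeq u) ∷ʳ dualAct κ  ∎

  private
    ¬design-plus-plus : ∀ u a b r → p ≡ u ++ a ∷ b ∷ r → pol a ≡ plus → pol b ≡ plus → ⊥
    ¬design-plus-plus u a b r eq pa pb = chronicle-¬plus-plus u a b (chronicles D _ ch) pa pb
      where ch = steps-design (u ∷ʳ a) b r (trans eq (sym (∷ʳ-++ u a (b ∷ r)))) pb

    ¬net-plus-plus : ∀ u a b r → p ≡ u ++ a ∷ b ∷ r → pol (dualAct a) ≡ plus → pol b ≡ minus → ⊥
    ¬net-plus-plus u a b r eq pa pb
      with i , ch ← steps-net (u ∷ʳ a) b r (trans eq (sym (∷ʳ-++ u a (b ∷ r)))) pb =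
      chronicle-¬plus-plus (dualSeq u) (dualAct a) (dualAct b)
        (subst (λ v → IsChronicle _ (view v ∷ʳ dualAct b)) (map-++ dualAct u [ a ])
          (chronicles (R i) _ ch))
        pa (pol-dualAct-minus b pb)

  steps-alternating : ∀ u a b r → p ≡ u ++ a ∷ b ∷ r → pol a ≢ pol b
  steps-alternating u a b r eq pa≡pb with pol-plus⊎minus b
  ... | inj₁ pb = ¬design-plus-plus u a b r eq (trans pa≡pb pb) pb
  ... | inj₂ pb = ¬net-plus-plus u a b r eq (pol-dualAct-minus a (trans pa≡pb pb)) pb

  steps-daimon-last : ∀ u b r → p ≢ u ++ daimon ∷ b ∷ r
  steps-daimon-last u b r eq with pol-plus⊎minus b
  ... | inj₁ pb = ¬design-plus-plus u daimon b r eq refl pb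
  ... | inj₂ pb = ¬net-plus-plus u daimon b r eq refl pb

net-daimon⇒LastNotNegative : ∀ {s} p → IsChronicle s (view (dualSeq p ∷ʳ daimon)) → LastNotNegative p
net-daimon⇒LastNotNegative p ch w c refl pc =
  chronicle-¬plus-plus (dualSeq w) (dualAct c) daimon (subst (IsChronicle _) chronicle≡ ch)
    (pol-dualAct-minus c pc) refl
  where
  chronicle≡ : view (dualSeq (w ∷ʳ c) ∷ʳ daimon) ≡ view (dualSeq w ∷ʳ dualAct c) ∷ʳ daimon
  chronicle≡ = begin
    view (dualSeq (w ∷ʳ c) ∷ʳ daimon)        ≡⟨ view-∷ʳ-plus (dualSeq (w ∷ʳ c)) daimon refl ⟩
    view (dualSeq (w ∷ʳ c)) ∷ʳ daimon        ≡⟨ cong (λ v → view v ∷ʳ daimon) (map-++ dualAct w [ c ]) ⟩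
    view (dualSeq w ∷ʳ dualAct c) ∷ʳ daimon  ∎

-- The dual p̃ of a sequence

tildeR-∷ʳ : ∀ v a → a ≢ daimon ⊎ v ≢ [] → tildeR (v ∷ʳ a) ≡ tildeR v ∷ʳ dualAct a
tildeR-∷ʳ []              daimon      (inj₁ a≢✠) = ⊥-elim (a≢✠ refl)
tildeR-∷ʳ []              daimon      (inj₂ v≢[]) = ⊥-elim (v≢[] refl)
tildeR-∷ʳ []              (act _ _ _) _ = refl
tildeR-∷ʳ (daimon ∷ w)    a           _ = map-++ dualAct w [ a ]
tildeR-∷ʳ (act e ξ I ∷ w) a           _ =
  cong (λ w′ → daimon ∷ act (flipPol e) ξ I ∷ w′) (map-++ dualAct w [ a ])

tilde-∷ : ∀ a r → a ≢ daimon ⊎ r ≢ [] → tilde (a ∷ r) ≡ dualAct a ∷ tilde r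
tilde-∷ a r h = begin
  reverse (tildeR (reverse (a ∷ r)))        ≡⟨ cong (reverse ∘ tildeR) (unfold-reverse a r) ⟩
  reverse (tildeR (reverse r ∷ʳ a))         ≡⟨ cong reverse (tildeR-∷ʳ (reverse r) a h′) ⟩
  reverse (tildeR (reverse r) ∷ʳ dualAct a) ≡⟨ reverse-++ (tildeR (reverse r)) [ dualAct a ] ⟩
  dualAct a ∷ tilde r                        ∎
  where
  h′ : a ≢ daimon ⊎ reverse r ≢ []
  h′ = Sum.map₂ (λ r≢[] → r≢[] ∘ reverse-injective) h

tilde-++-∷ : ∀ w a r → a ≢ daimon → tilde (w ++ a ∷ r) ≡ dualSeq w ++ dualAct a ∷ tilde r
tilde-++-∷ []      a r a≢✠ = tilde-∷ a r (inj₁ a≢✠)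
tilde-++-∷ (x ∷ w) a r a≢✠ =
  trans (tilde-∷ x (w ++ a ∷ r) (inj₂ (++-∷≢[] w))) (cong (dualAct x ∷_) (tilde-++-∷ w a r a≢✠))

tilde-∷ʳ-daimon : ∀ w → tilde (w ∷ʳ daimon) ≡ dualSeq w
tilde-∷ʳ-daimon []      = refl
tilde-∷ʳ-daimon (x ∷ w) =
  trans (tilde-∷ x (w ∷ʳ daimon) (inj₂ (++-∷≢[] w))) (cong (dualAct x ∷_) (tilde-∷ʳ-daimon w))

tilde-daimon-free : ∀ p → daimon ∉ p → tilde p ≡ dualSeq p ∷ʳ daimon
tilde-daimon-free []      _   = refl
tilde-daimon-free (x ∷ p) ✠∉ =
  trans (tilde-∷ x p (inj₁ (∉-++-∷ [] ✠∉))) (cong (dualAct x ∷_) (tilde-daimon-free p (✠∉ ∘ there)))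

-- Coherence of the duals

PositiveDeterministic : List Action → List Action → Set
PositiveDeterministic p₁ p₂ = ∀ w₁ κ₁ r₁ w₂ κ₂ r₂ → p₁ ≡ w₁ ++ κ₁ ∷ r₁ → p₂ ≡ w₂ ++ κ₂ ∷ r₂ →
  pol κ₁ ≡ plus → pol κ₂ ≡ plus → view w₁ ≡ view w₂ → κ₁ ≡ κ₂

PositiveDeterministic-sym : ∀ {p q} → PositiveDeterministic p q → PositiveDeterministic q p
PositiveDeterministic-sym det w₁ κ₁ r₁ w₂ κ₂ r₂ e₁ e₂ p₁ p₂ v =
  sym (det w₂ κ₂ r₂ w₁ κ₁ r₁ e₂ e₁ p₂ p₁ (sym v))

¬fork-plus-minus : ∀ {β} (D D′ : Design β) (R R′ : Net (perp β)) w {a b} r s →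
  Steps D R (w ++ a ∷ r) → Steps D′ R′ (w ++ b ∷ s) → pol a ≡ plus → pol b ≡ minus → ⊥
¬fork-plus-minus D D′ R R′ w {a} {b} r s sp sq pa pb with initLast w
... | [] with i , ch ← steps-net D′ R′ sq [] b s refl pb =
  opening-clash D R′ i (steps-design D R sp [] a r refl pa) ch pa (pol-dualAct-minus b pb)
... | w₀ ∷ʳ′ c with pol-plus⊎minus c
...   | inj₁ pc = steps-alternating D R sp w₀ c a r (∷ʳ-++ w₀ c (a ∷ r)) (trans pc (sym pa))
...   | inj₂ pc = steps-alternating D′ R′ sq w₀ c b s (∷ʳ-++ w₀ c (b ∷ s)) (trans pc (sym pb))

module _ {β : Sequent} (D D′ : Design β) (R R′ : Net (perp β)) where

  fork-¬tilde-deterministic : ∀ w {a b} r s → a ≢ b →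
    Steps D R (w ++ a ∷ r) → Steps D′ R′ (w ++ b ∷ s) → PositiveDeterministic (w ++ a ∷ r) (w ++ b ∷ s) →
    ¬ PositiveDeterministic (tilde (w ++ a ∷ r)) (tilde (w ++ b ∷ s))
  fork-¬tilde-deterministic w {a} {b} r s a≢b sp sq det tdet with pol-plus⊎minus a | pol-plus⊎minus b
  ... | inj₁ pa | inj₁ pb = a≢b (det w a r w b s refl refl pa pb refl)
  ... | inj₁ pa | inj₂ pb = ¬fork-plus-minus D D′ R R′ w r s sp sq pa pb
  ... | inj₂ pa | inj₁ pb = ¬fork-plus-minus D′ D R′ R w s r sq sp pb pa
  ... | inj₂ pa | inj₂ pb = a≢b (dualAct-injective
          (tdet (dualSeq w) (dualAct a) (tilde r) (dualSeq w) (dualAct b) (tilde s)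
            (tilde-++-∷ w a r (minus⇒≢daimon pa)) (tilde-++-∷ w b s (minus⇒≢daimon pb))
            (pol-dualAct-minus a pa) (pol-dualAct-minus b pb) refl))

  extension-¬tilde-deterministic : ∀ {p} b r → Visit D R p → Visit D′ R′ (p ++ b ∷ r) →
    ¬ PositiveDeterministic (tilde p) (tilde (p ++ b ∷ r))
  extension-¬tilde-deterministic b r (_ , inj₁ (w , refl)) (sq , _) _ =
    steps-daimon-last D′ R′ sq w b r (∷ʳ-++ w daimon (b ∷ r))
  extension-¬tilde-deterministic {p} b r (_ , inj₂ (✠∉p , i , ch)) (sq , _) tdet with pol-plus⊎minus b
  ... | inj₂ pb = minus⇒≢daimon pb (sym (dualAct-injective {daimon}
          (tdet (dualSeq p) daimon [] (dualSeq p) (dualAct b) (tilde r)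
            (tilde-daimon-free p ✠∉p) (tilde-++-∷ p b r (minus⇒≢daimon pb))
            refl (pol-dualAct-minus b pb) refl)))
  ... | inj₁ pb with initLast p
  ...   | [] = opening-clash D′ R i (steps-design D′ R′ sq [] b r refl pb) ch pb refl
  ...   | w ∷ʳ′ c with pol-plus⊎minus c
  ...     | inj₁ pc = steps-alternating D′ R′ sq w c b r (∷ʳ-++ w c (b ∷ r)) (trans pc (sym pb))
  ...     | inj₂ pc = net-daimon⇒LastNotNegative (w ∷ʳ c) (chronicles (R i) _ ch) w c refl pc

visits-coherent⇒tilde-incoherent : ∀ {β} (D D′ : Design β) (R R′ : Net (perp β)) {p q} →
  Visit D R p → Visit D′ R′ q → p ≢ q → Coherent p q → ¬ Coherent (tilde p) (tilde q)
visits-coherent⇒tilde-incoherent D D′ R R′ {p} {q} vp vq p≢q (_ , det , _) (_ , tdet , _)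
  with compare _≟ₐ_ p q
... | equal           = p≢q refl
... | fork w r s a≢b  = fork-¬tilde-deterministic D D′ R R′ w r s a≢b (proj₁ vp) (proj₁ vq) det tdet
... | prefix _ b s    = extension-¬tilde-deterministic D D′ R R′ b s vp vq tdet
... | extension _ a r =
  extension-¬tilde-deterministic D′ D R′ R a r vq vp (PositiveDeterministic-sym tdet)

-- Duals of visitable paths are paths on β⊥

tilde-start : ∀ {β} (D : Design β) R p → IsPath (β ∷ []) p → Steps D R p →
  ∀ s → s ∈ perp β → sneg s ≡ nothing →
  Σ Action λ κ → Σ (List Action) λ r →
    tilde p ≡ κ ∷ r × (κ ≡ daimon ⊎ (pol κ ≡ plus × FocusIn κ (spos s)))
tilde-start {just ξ ⊢ Δ} D R [] _ _ _ (here refl) _ = daimon , [] , refl , inj₁ refl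
tilde-start {just ξ ⊢ Δ} D R (daimon ∷ r) _ steps _ (here refl) _ with steps [] daimon r refl
... | inj₁ (_ , ch) with () ← chronicle-head-pol (chronicles D _ ch)
... | inj₂ (() , _)
tilde-start {just ξ ⊢ Δ} D R (act e ζ I ∷ r) path _ _ (here refl) _
  with refl , refl ← negBase-path-head path (λ ()) =
  act plus ξ I , tilde r , tilde-∷ (act minus ξ I) r (inj₁ λ ()) , inj₂ (refl , ξ , refl , here refl)
tilde-start {just ξ ⊢ Δ} D R p _ _ s (there s∈) sneg-s
  with _ , _ , refl ← ∈-map⁻ (λ σ → just σ ⊢ []) s∈ with () ← sneg-s
tilde-start {nothing ⊢ Δ} D R p _ _ s s∈ sneg-s
  with _ , _ , refl ← ∈-map⁻ (λ σ → just σ ⊢ []) s∈ with () ← sneg-s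

module _ {β : Sequent} (D : Design β) (R : Net (perp β)) (p : List Action)
         (path : IsPath (β ∷ []) p) (visit : Visit D R p) where

  data Position (u′ : List Action) (κ : Action) (r′ : List Action) : Set where
    dual-of      : ∀ u κ₀ r → p ≡ u ++ κ₀ ∷ r → κ₀ ≢ daimon →
                   u′ ≡ dualSeq u → κ ≡ dualAct κ₀ → Position u′ κ r′
    final-daimon : daimon ∉ p → LastNotNegative p →
                   u′ ≡ dualSeq p → κ ≡ daimon → r′ ≡ [] → Position u′ κ r′

  private
    daimon∉init : ∀ c → p ≡ c ∷ʳ daimon → daimon ∉ c
    daimon∉init c eq ✠∈c with u , r , refl ← ∈-∃++ ✠∈c =
      ++-∷≢[] r (IsPath.daimonLast path u (r ∷ʳ daimon) (trans eq (++-assoc u (daimon ∷ r) [ daimon ])))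

  tilde-shape : (∃ λ c → p ≡ c ∷ʳ daimon × daimon ∉ c × tilde p ≡ dualSeq c)
              ⊎ (daimon ∉ p × LastNotNegative p × tilde p ≡ dualSeq p ∷ʳ daimon)
  tilde-shape with proj₂ visit
  ... | inj₁ (c , p≡) = inj₁ (c , p≡ , daimon∉init c p≡ , trans (cong tilde p≡) (tilde-∷ʳ-daimon c))
  ... | inj₂ (✠∉p , i , ch) =
    inj₂ (✠∉p , net-daimon⇒LastNotNegative p (chronicles (R i) _ ch) , tilde-daimon-free p ✠∉p)

  position : ∀ u′ κ r′ → tilde p ≡ u′ ++ κ ∷ r′ → Position u′ κ r′
  position u′ κ r′ eq with tilde-shape
  ... | inj₁ (c , p≡ , ✠∉c , p̃≡)
    with u , κ₀ , r , refl , refl , refl , _ ← map-split dualAct c u′ r′ (trans (sym p̃≡) eq) =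
    dual-of u κ₀ (r ∷ʳ daimon) (trans p≡ (++-assoc u (κ₀ ∷ r) [ daimon ])) (∉-++-∷ u ✠∉c) refl refl
  ... | inj₂ (✠∉p , last , p̃≡) with ∷ʳ-split (dualSeq p) daimon u′ r′ (trans (sym p̃≡) eq)
  ...   | inj₂ (refl , refl , refl) = final-daimon ✠∉p last refl refl refl
  ...   | inj₁ (_ , p̄≡) with u , κ₀ , r , p≡ , refl , refl , _ ← map-split dualAct p u′ _ p̄≡ =
    dual-of u κ₀ r p≡ (∉-++-∷ u (subst (daimon ∉_) p≡ ✠∉p)) refl refl

  tilde-alternating : ∀ u′ a b r′ → tilde p ≡ u′ ++ a ∷ b ∷ r′ → pol a ≢ pol b
  tilde-alternating u′ a b r′ eq with position (u′ ∷ʳ a) b r′ (trans eq (sym (∷ʳ-++ u′ a (b ∷ r′))))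
  ... | dual-of u b₀ r p≡ b₀≢✠ u′a≡ refl
    with ua , a₀ , refl , refl , refl ← map-≡-∷ʳ dualAct u u′ (sym u′a≡) =
    pol-dualAct-≢ a₀≢✠ b₀≢✠ (IsPath.alternating path ua a₀ b₀ r p≡′)
    where
    p≡′ : p ≡ ua ++ a₀ ∷ b₀ ∷ r
    p≡′ = trans p≡ (∷ʳ-++ ua a₀ (b₀ ∷ r))
    a₀≢✠ : a₀ ≢ daimon
    a₀≢✠ refl with () ← IsPath.daimonLast path ua (b₀ ∷ r) p≡′
  ... | final-daimon ✠∉p last u′a≡ refl _
    with ua , a₀ , p≡ , refl , refl ← map-≡-∷ʳ dualAct p u′ (sym u′a≡)
    with pol-plus⊎minus a₀
  ...   | inj₂ pa₀ = ⊥-elim (last ua a₀ p≡ pa₀)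
  ...   | inj₁ pa₀ = λ pa≡p✠ → plus≢minus (trans (sym pa≡p✠) (pol-dualAct-plus a₀≢✠ pa₀))
    where
    a₀≢✠ : a₀ ≢ daimon
    a₀≢✠ = ∉-++-∷ ua (subst (daimon ∉_) p≡ ✠∉p)

  tilde-daimonLast : ∀ u′ r′ → tilde p ≡ u′ ++ daimon ∷ r′ → r′ ≡ []
  tilde-daimonLast u′ r′ eq with position u′ daimon r′ eq
  ... | dual-of _ κ₀ _ _ κ₀≢✠ _ ✠≡ = ⊥-elim (κ₀≢✠ (dualAct-injective (sym ✠≡)))
  ... | final-daimon _ _ _ _ r′≡[] = r′≡[]

  tilde-distinct : AllDistinctFoci (tilde p)
  tilde-distinct u′ a v′ b r′ eq
    with position (u′ ++ a ∷ v′) b r′ (trans eq (sym (++-assoc u′ (a ∷ v′) (b ∷ r′))))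
  ... | final-daimon _ _ _ refl _ = λ _ _ ()
  ... | dual-of u b₀ r p≡ _ u′av′≡ refl
    with ua , a₀ , va , refl , refl , refl , refl ← map-split dualAct u u′ v′ (sym u′av′≡) = λ ζ fa fb →
    IsPath.distinct path ua a₀ va b₀ r (trans p≡ (++-assoc ua (a₀ ∷ va) (b₀ ∷ r))) ζ
      (trans (sym (focus-dualAct a₀)) fa) (trans (sym (focus-dualAct b₀)) fb)

  tilde-justified : ∀ u′ κ r′ → tilde p ≡ u′ ++ κ ∷ r′ → Proper κ →
    InitialIn (perp β) κ ⊎ (Σ Action λ κ′ → κ′ ∈ u′ × Justifies κ′ κ)
  tilde-justified u′ κ r′ eq κ-proper with position u′ κ r′ eq
  ... | final-daimon _ _ _ κ≡✠ _ = ⊥-elim (Proper⇒≢daimon κ-proper κ≡✠)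
  ... | dual-of u κ₀ r p≡ κ₀≢✠ refl refl with IsPath.justified path u κ₀ r p≡ (≢daimon⇒Proper κ₀≢✠)
  ...   | inj₁ initial        = inj₁ (initialIn-perp β κ₀ initial)
  ...   | inj₂ (κ′ , κ′∈ , J) = inj₂ (dualAct κ′ , ∈-map⁺ dualAct κ′∈ , justifies-dualAct κ′ κ₀ J)

  tilde-visibility : ∀ u′ κ r′ κ′ → tilde p ≡ u′ ++ κ ∷ r′ → pol κ ≡ plus →
    κ′ ∈ u′ → Justifies κ′ κ → κ′ ∈ view u′
  tilde-visibility u′ κ r′ κ′ eq pκ κ′∈ J with position u′ κ r′ eq
  ... | final-daimon _ _ _ refl _ with _ , _ , _ , () ← justifier-focus κ′ daimon J
  ... | dual-of u κ₀ r p≡ κ₀≢✠ refl refl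
    with i , ch ← steps-net D R (proj₁ visit) u κ₀ r p≡ (pol-dualAct≡plus⇒minus κ₀≢✠ pκ)
    with IsChronicle.posJust (chronicles (R i) _ ch) (view (dualSeq u)) (dualAct κ₀) [] refl pκ
           (≢daimon⇒Proper (κ₀≢✠ ∘ dualAct-injective))
  ...   | inj₁ (ζ , fκ , ζ∈)
    with refl ← negBase-path-focus path (proj₁ (perp-spos β (∈-lookup {xs = perp β} i) ζ∈)) u κ₀ r p≡
                  (trans (sym (focus-dualAct κ₀)) fκ)
    with () ← κ′∈
  ...   | inj₂ (κ″ , κ″∈ , J″) with _ , _ , fκ′ , _ ← justifier-focus κ′ _ J =
    subst (_∈ view (dualSeq u)) (sym κ′≡κ″) κ″∈
    where
    distinct : AllDistinctFoci (dualSeq u)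
    distinct = AllDistinctFoci-++⁻ˡ (dualSeq u) _ (subst AllDistinctFoci eq tilde-distinct)
    κ′≡κ″ : κ′ ≡ κ″
    κ′≡κ″ = AllDistinctFoci⇒focus-injective distinct κ′∈ (view-⊆ (dualSeq u) κ″∈)
              fκ′ (trans (sym (justifier-focus-unique κ′ κ″ _ J J″)) fκ′)

  tilde-initPos : ∀ u′ κ r′ s → tilde p ≡ u′ ++ κ ∷ r′ → pol κ ≡ plus → s ∈ perp β → FocusIn κ (spos s) →
    (u′ ≡ [] × sneg s ≡ nothing) ⊎
    (Σ (List Action) λ u″ → Σ Action λ κ″ → u′ ≡ u″ ++ κ″ ∷ [] × pol κ″ ≡ minus × HJFrom s κ″)
  tilde-initPos u′ κ r′ s eq _ s∈ (ζ , fκ , ζ∈) with perp-spos β s∈ ζ∈ | position u′ κ r′ eq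
  ... | _ | final-daimon _ _ _ κ≡✠ _ = ⊥-elim (Proper⇒≢daimon (ζ , fκ) κ≡✠)
  ... | sneg-β , sneg-s | dual-of u κ₀ r p≡ _ refl refl
    with refl ← negBase-path-focus path sneg-β u κ₀ r p≡ (trans (sym (focus-dualAct κ₀)) fκ) =
    inj₁ (refl , sneg-s)

  tilde-isPath : IsPath (perp β) (tilde p)
  tilde-isPath = record
    { alternating = tilde-alternating
    ; daimonLast  = tilde-daimonLast
    ; distinct    = tilde-distinct
    ; justified   = tilde-justified
    ; visibility  = tilde-visibility
    ; initPos     = tilde-initPos
    ; start       = tilde-start D R p path (proj₁ visit)
    }

tildeSet-antiClique : ∀ {C : List Action → Set} →
  (∀ {p q} → C p → C q → p ≢ q → Coherent p q → ¬ Coherent (tilde p) (tilde q)) →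
  Clique C → AntiClique (TildeSet C)
tildeSet-antiClique tilde-incoherent clique _ _ (p , Cp , refl) (q , Cq , refl) p̃≢q̃ =
  tilde-incoherent Cp Cq p≢q (clique p q Cp Cq p≢q)
  where
  p≢q : p ≢ q
  p≢q = p̃≢q̃ ∘ cong tilde

proposition5p9 : (β : Sequent) → WFBase β → (E : Design β → Set) →
    (∀ p q → Visitable E p → Visitable E q → p ≢ q →
       Coherent p q → ¬ Coherent (tilde p) (tilde q))
    ×
    (∀ (C : List Action → Set) →
       (∀ p → C p → IsPath (β ∷ []) p × Visitable E p) → Clique C →
       AntiClique (TildeSet C) × (∀ x → TildeSet C x → IsPath (perp β) x))
proposition5p9 β _ E = visitable-coherent⇒tilde-incoherent , λ C C⊆ clique →
    tildeSet-antiClique (λ {p} {q} Cp Cq → visitable-coherent⇒tilde-incoherent p q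
                           (proj₂ (C⊆ p Cp)) (proj₂ (C⊆ q Cq))) clique
  , λ { _ (p , Cp , refl) → tilde-path p (C⊆ p Cp) }
  where
  visitable-coherent⇒tilde-incoherent : ∀ p q → Visitable E p → Visitable E q → p ≢ q →
    Coherent p q → ¬ Coherent (tilde p) (tilde q)
  visitable-coherent⇒tilde-incoherent _ _ (D , R , _ , _ , vp) (D′ , R′ , _ , _ , vq) =
    visits-coherent⇒tilde-incoherent D D′ R R′ vp vq

  tilde-path : ∀ p → IsPath (β ∷ []) p × Visitable E p → IsPath (perp β) (tilde p)
  tilde-path p (path , D , R , _ , _ , visit) = tilde-isPath D R p path visit
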